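{- Let $k\ge 3$ and $n\ge k+2$ be integers. Then: (1) $P_n^3$ is odd prime if and only if $n\in\{5,6,7,9,10,13\}$; (2) $P_n^4$ is odd prime if and only if $n\in\{6,7\}$; (3) $P_n^5$ is odd prime if and only if $n=7$; (4) if $k\ge 6$, then $P_n^k$ is not odd prime; (5) $C_n^k$ is not odd prime.
   Context: All graphs are finite and simple. An odd prime labeling of a graph $G$ with $N$ vertices is a bijection $\ell:V(G)\to\{1,3,\dots,2N-1\}$ such that $\gcd(\ell(u),\ell(v))=1$ for every edge $uv$; $G$ is odd prime if it has one. $P_n$ is the path on $n$ vertices and $C_n$ the cycle on $n$ vertices. For a graph $G$ and $k\ge 1$, the $k$th power $G^k$ has the same vertex set as $G$, with distinct vertices $u,v$ adjacent iff their distance in $G$ is at most $k$. -}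

module Defs where

open import Data.Nat using (ℕ; _+_; _*_; _∸_; _≤_; ∣_-_∣; _⊓_)
open import Data.Nat.GCD using (gcd)
open import Data.Fin using (Fin; toℕ)
open import Data.Product using (Σ; _×_)
open import Relation.Binary.PropositionalEquality using (_≡_; _≢_)
open import Function.Definitions using (Bijective)

Graph : ℕ → Set₁
Graph N = Fin N → Fin N → Set

distP : ∀ {N} → Fin N → Fin N → ℕ
distP i j = ∣ toℕ i - toℕ j ∣

distC : ∀ {N} → Fin N → Fin N → ℕ
distC {N} i j = ∣ toℕ i - toℕ j ∣ ⊓ (N ∸ ∣ toℕ i - toℕ j ∣)

PathPow : (N k : ℕ) → Graph N
PathPow N k u v = (u ≢ v) × (distP u v ≤ k)

CyclePow : (N k : ℕ) → Graph N
CyclePow N k u v = (u ≢ v) × (distC u v ≤ k)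

oddNum : ∀ {N} → Fin N → ℕ
oddNum i = 2 * toℕ i + 1

-- An odd prime labeling: a bijection V → {1,3,…,2N-1}, encoded as a
-- bijection σ : Fin N → Fin N composed with oddNum, such that adjacent
-- vertices receive coprime labels.
OddPrimeLabeling : ∀ {N} → Graph N → Set
OddPrimeLabeling {N} G =
  Σ (Fin N → Fin N) λ σ →
    Bijective _≡_ _≡_ σ ×
    (∀ u v → G u v → gcd (oddNum (σ u)) (oddNum (σ v)) ≡ 1)

IsOddPrime : ∀ {N} → Graph N → Set
IsOddPrime G = OddPrimeLabeling G

{-# OPTIONS --safe #-}
-- Among the labels 1, 3, …, 2N - 1 the ⌊(N + 1) / 3⌋ multiples 3, 9, 15, … of 3 pairwise share
-- a factor, so the vertices carrying them lie pairwise at distance > k. In P_N^k every block of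
-- k + 1 consecutive vertices holds at most one of them, and in C_N^k the arcs of k + 1 vertices
-- starting at them are disjoint. These counts rule out C_N^k always, P_N^k for k ≥ 4 and N ≥ 8,
-- and P_N^3 for N = 8, 11, 12 and N ≥ 14; the remaining graphs get explicit labelings, checked
-- by a decision procedure.
module Submission where

open import Defs
open import Data.Nat using (ℕ; suc; _+_; _*_; _∸_; _≤_; _<_; _≤?_; _<?_; _≟_; ∣_-_∣; _⊔_; s≤s; s≤s⁻¹; NonZero; >-nonZero)
open import Data.Nat.Properties
open import Data.Nat.DivMod using (_/_; _%_; m≡m%n+[m/n]*n; m%n<n; m/n*n≤m; /-monoˡ-≤; m*n/n≡m; m<n*o⇒m/o<n)
open import Data.Nat.Divisibility using (_∣_; divides)
open import Data.Nat.Coprimality using (gcd≡1⇒coprime)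
open import Data.Nat.GCD using (gcd)
open import Data.Nat.Tactic.RingSolver using (solve-∀)
open import Data.Fin using (Fin; toℕ; fromℕ<; remQuot; combine; #_)
open import Data.Fin.Properties using (toℕ-fromℕ<; toℕ-injective; toℕ<n; injective⇒≤; combine-remQuot; all?; any?) renaming (_≟_ to _≟ᶠ_)
open import Data.Vec using (lookup; _∷_; [])
open import Data.Product using (Σ-syntax; ∃-syntax; _×_; _,_; proj₁; proj₂; uncurry)
open import Data.Sum using (_⊎_; inj₁; inj₂)
open import Data.Empty using (⊥-elim)
open import Function using (_∘_)
open import Function.Bundles using (_⇔_; mk⇔)
open import Function.Definitions using (Injective)
open import Relation.Nullary using (¬_; yes; no; contradiction)
open import Relation.Nullary.Decidable using (Dec; True; toWitness; ¬?; _×-dec_; _→-dec_)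
open import Relation.Binary.PropositionalEquality

Independent : ∀ {N m} → Graph N → (Fin m → Fin N) → Set
Independent G f = Injective _≡_ _≡_ f × (∀ i j → ¬ G (f i) (f j))

labelsWithCommonDivisor-independent : ∀ {N m d} {G : Graph N} → OddPrimeLabeling G → 1 < d →
  (ℓ : Fin m → Fin N) → Injective _≡_ _≡_ ℓ → (∀ i → d ∣ oddNum (ℓ i)) →
  Σ[ f ∈ (Fin m → Fin N) ] Independent G f
labelsWithCommonDivisor-independent {N} {m} {d} {G} (σ , (_ , σ-surjective) , coprime) 1<d ℓ ℓ-injective d∣ℓ =
  σ⁻¹ ∘ ℓ , injective , independent
  where
  σ⁻¹ : Fin N → Fin N
  σ⁻¹ y = proj₁ (σ-surjective y)
  σ∘σ⁻¹ : ∀ y → σ (σ⁻¹ y) ≡ y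
  σ∘σ⁻¹ y = proj₂ (σ-surjective y) refl
  injective : Injective _≡_ _≡_ (σ⁻¹ ∘ ℓ)
  injective {i} {j} e = ℓ-injective (trans (sym (σ∘σ⁻¹ (ℓ i))) (trans (cong σ e) (σ∘σ⁻¹ (ℓ j))))
  d∣label : ∀ i → d ∣ oddNum (σ (σ⁻¹ (ℓ i)))
  d∣label i = subst (λ y → d ∣ oddNum y) (sym (σ∘σ⁻¹ (ℓ i))) (d∣ℓ i)
  independent : ∀ i j → ¬ G (σ⁻¹ (ℓ i)) (σ⁻¹ (ℓ j))
  independent i j edge = <⇒≢ 1<d (sym (gcd≡1⇒coprime (coprime _ _ edge) (d∣label i , d∣label j)))

module _ {N m : ℕ} (c : ℕ) (bound : (2 * c + 1) * m ≤ N + c) where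

  oddMultiple< : (j : Fin m) → (2 * c + 1) * toℕ j + c < N
  oddMultiple< j = +-cancelʳ-≤ c _ _ (begin
      suc ((2 * c + 1) * toℕ j + c) + c ≡⟨ expand c (toℕ j) ⟩
      (2 * c + 1) * suc (toℕ j)         ≤⟨ *-monoʳ-≤ (2 * c + 1) (toℕ<n j) ⟩
      (2 * c + 1) * m                   ≤⟨ bound ⟩
      N + c                             ∎)
    where
    open ≤-Reasoning
    expand : ∀ c j → suc ((2 * c + 1) * j + c) + c ≡ (2 * c + 1) * suc j
    expand = solve-∀

  oddMultiple : Fin m → Fin N
  oddMultiple j = fromℕ< (oddMultiple< j)

  oddNum-oddMultiple : ∀ j → oddNum (oddMultiple j) ≡ (2 * toℕ j + 1) * (2 * c + 1)
  oddNum-oddMultiple j = trans (cong (λ x → 2 * x + 1) (toℕ-fromℕ< (oddMultiple< j))) (factor c (toℕ j))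
    where
    factor : ∀ c j → 2 * ((2 * c + 1) * j + c) + 1 ≡ (2 * j + 1) * (2 * c + 1)
    factor = solve-∀

  oddMultiple-injective : Injective _≡_ _≡_ oddMultiple
  oddMultiple-injective {i} {j} e = toℕ-injective (*-cancelˡ-≡ (toℕ i) (toℕ j) (2 * c + 1)
      {{>-nonZero (m≤n+m 1 (2 * c))}}
      (+-cancelʳ-≡ c _ _ (trans (sym (toℕ-fromℕ< (oddMultiple< i))) (trans (cong toℕ e) (toℕ-fromℕ< (oddMultiple< j))))))

oddMultiples-independent : ∀ {N m} {G : Graph N} → OddPrimeLabeling G → (c : ℕ) → 0 < c →
  (2 * c + 1) * m ≤ N + c → Σ[ f ∈ (Fin m → Fin N) ] Independent G f
oddMultiples-independent labeling c 0<c bound =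
  labelsWithCommonDivisor-independent labeling (≤-trans (*-monoʳ-≤ 2 0<c) (m≤m+n (2 * c) 1))
    (oddMultiple c bound) (oddMultiple-injective c bound)
    (λ j → divides (2 * toℕ j + 1) (oddNum-oddMultiple c bound j))

m/o≡n/o⇒∣m-n∣<o : ∀ m n o .{{_ : NonZero o}} → m / o ≡ n / o → ∣ m - n ∣ < o
m/o≡n/o⇒∣m-n∣<o m n o e = begin-strict
    ∣ m - n ∣
  ≡⟨ cong₂ ∣_-_∣ (trans (m≡m%n+[m/n]*n m o) (+-comm (m % o) _))
                 (trans (m≡m%n+[m/n]*n n o) (+-comm (n % o) _)) ⟩
    ∣ m / o * o + m % o - n / o * o + n % o ∣
  ≡⟨ cong (λ q → ∣ m / o * o + m % o - q * o + n % o ∣) (sym e) ⟩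
    ∣ m / o * o + m % o - m / o * o + n % o ∣
  ≡⟨ ∣m+n-m+o∣≡∣n-o∣ (m / o * o) _ _ ⟩
    ∣ m % o - n % o ∣
  ≤⟨ ∣m-n∣≤m⊔n (m % o) (n % o) ⟩
    m % o ⊔ n % o
  <⟨ ⊔-lub (m%n<n m o) (m%n<n n o) ⟩
    o ∎
  where open ≤-Reasoning

pathPow-independent-≤ : ∀ {N k m b} {f : Fin m → Fin N} → Independent (PathPow N k) f →
  N ≤ b * suc k → m ≤ b
pathPow-independent-≤ {N} {k} {m} {b} {f} (f-injective , independent) N≤b[1+k] =
  injective⇒≤ block-injective
  where
  block : Fin m → Fin b
  block i = fromℕ< (m<n*o⇒m/o<n {o = suc k} (<-≤-trans (toℕ<n (f i)) N≤b[1+k]))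
  block-injective : Injective _≡_ _≡_ block
  block-injective {i} {j} e with i ≟ᶠ j
  ... | yes i≡j = i≡j
  ... | no i≢j = ⊥-elim (independent i j (i≢j ∘ f-injective , s≤s⁻¹ close))
    where
    close : distP (f i) (f j) < suc k
    close = m/o≡n/o⇒∣m-n∣<o (toℕ (f i)) (toℕ (f j)) (suc k)
      (trans (sym (toℕ-fromℕ< _)) (trans (cong toℕ e) (toℕ-fromℕ< _)))

-- Reduction modulo N of a number below 2N.
wrap : ℕ → ℕ → ℕ
wrap N x with x <? N
... | yes _ = x
... | no _  = x ∸ N

wrap-cases : ∀ N x → wrap N x ≡ x ⊎ N + wrap N x ≡ x
wrap-cases N x with x <? N
... | yes _   = inj₁ refl
... | no x≮N = inj₂ (m+[n∸m]≡n (≮⇒≥ x≮N))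

wrap-< : ∀ {N x} → x < N + N → wrap N x < N
wrap-< {N} {x} x<2N with x <? N
... | yes x<N = x<N
... | no x≮N = subst (x ∸ N <_) (m+n∸n≡m N N) (∸-monoˡ-< x<2N (≮⇒≥ x≮N))

wrap-collision : ∀ {N x y} → wrap N x ≡ wrap N y → x ≡ y ⊎ N + x ≡ y ⊎ x ≡ N + y
wrap-collision {N} {x} {y} e with wrap-cases N x | wrap-cases N y
... | inj₁ x′≡x | inj₁ y′≡y = inj₁ (trans (sym x′≡x) (trans e y′≡y))
... | inj₁ x′≡x | inj₂ y′≡y = inj₂ (inj₁ (trans (cong (N +_) (trans (sym x′≡x) e)) y′≡y))
... | inj₂ x′≡x | inj₁ y′≡y = inj₂ (inj₂ (trans (sym x′≡x) (cong (N +_) (trans e y′≡y))))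
... | inj₂ x′≡x | inj₂ y′≡y = inj₁ (trans (sym x′≡x) (trans (cong (N +_) e) y′≡y))

m+n≡o+p⇒∣m-o∣≡∣p-n∣ : ∀ m n o p → m + n ≡ o + p → ∣ m - o ∣ ≡ ∣ p - n ∣
m+n≡o+p⇒∣m-o∣≡∣p-n∣ m n o p e = begin
  ∣ m - o ∣          ≡⟨ ∣m+n-m+o∣≡∣n-o∣ n m o ⟨
  ∣ n + m - n + o ∣  ≡⟨ cong₂ ∣_-_∣ (trans (+-comm n m) e) (+-comm n o) ⟩
  ∣ o + p - o + n ∣  ≡⟨ ∣m+n-m+o∣≡∣n-o∣ o p n ⟩
  ∣ p - n ∣          ∎
  where open ≡-Reasoning

m∸∣n-o∣≤∣n+m-o∣ : ∀ m n o → m ∸ ∣ n - o ∣ ≤ ∣ n + m - o ∣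
m∸∣n-o∣≤∣n+m-o∣ m n o = m≤n+o⇒m∸n≤o m ∣ n - o ∣ (begin
  m                              ≡⟨ ∣m-m+n∣≡n n m ⟨
  ∣ n - n + m ∣                  ≤⟨ ∣-∣-triangle n o (n + m) ⟩
  ∣ n - o ∣ + ∣ o - n + m ∣      ≡⟨ cong (∣ n - o ∣ +_) (∣-∣-comm o (n + m)) ⟩
  ∣ n - o ∣ + ∣ n + m - o ∣      ∎)
  where open ≤-Reasoning

wrap-+-collision : ∀ {N p q s t} → wrap N (p + t) ≡ wrap N (q + s) →
  ∣ p - q ∣ ≡ ∣ s - t ∣ ⊎ N ∸ ∣ p - q ∣ ≤ ∣ s - t ∣
wrap-+-collision {N} {p} {q} {s} {t} e with wrap-collision {N} {p + t} {q + s} e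
... | inj₁ p+t≡q+s = inj₁ (m+n≡o+p⇒∣m-o∣≡∣p-n∣ p t q s p+t≡q+s)
... | inj₂ (inj₁ N+[p+t]≡q+s) = inj₂ (begin
  N ∸ ∣ p - q ∣      ≤⟨ m∸∣n-o∣≤∣n+m-o∣ N p q ⟩
  ∣ p + N - q ∣      ≡⟨ m+n≡o+p⇒∣m-o∣≡∣p-n∣ (p + N) t q s
                          (trans (cong (_+ t) (+-comm p N)) (trans (+-assoc N p t) N+[p+t]≡q+s)) ⟩
  ∣ s - t ∣          ∎)
  where open ≤-Reasoning
... | inj₂ (inj₂ p+t≡N+[q+s]) = inj₂ (begin
  N ∸ ∣ p - q ∣      ≡⟨ cong (N ∸_) (∣-∣-comm p q) ⟩
  N ∸ ∣ q - p ∣      ≤⟨ m∸∣n-o∣≤∣n+m-o∣ N q p ⟩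
  ∣ q + N - p ∣      ≡⟨ m+n≡o+p⇒∣m-o∣≡∣p-n∣ (q + N) s p t
                          (trans (cong (_+ s) (+-comm q N)) (trans (+-assoc N q s) (sym p+t≡N+[q+s]))) ⟩
  ∣ t - s ∣          ≡⟨ ∣-∣-comm t s ⟩
  ∣ s - t ∣          ∎)
  where open ≤-Reasoning

remQuot-injective : ∀ {m} n {x y : Fin (m * n)} → remQuot {m} n x ≡ remQuot n y → x ≡ y
remQuot-injective {m} n {x} {y} e = begin
  x                                 ≡⟨ combine-remQuot {m} n x ⟨
  uncurry combine (remQuot {m} n x) ≡⟨ cong (uncurry combine) e ⟩
  uncurry combine (remQuot {m} n y) ≡⟨ combine-remQuot {m} n y ⟩
  y                                 ∎
  where open ≡-Reasoning

-- The arcs of length k + 1 starting at the members of an independent family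
-- are pairwise disjoint.
cyclePow-independent-≤ : ∀ {N k m} {f : Fin m → Fin N} → k < N → Independent (CyclePow N k) f →
  m * suc k ≤ N
cyclePow-independent-≤ {N} {k} {m} {f} k<N (f-injective , independent) =
  injective⇒≤ {f = arc ∘ remQuot {m} (suc k)} (λ e → remQuot-injective (suc k) (arc-injective e))
  where
  arc : Fin m × Fin (suc k) → Fin N
  arc (i , t) = fromℕ< (wrap-< (+-mono-< (toℕ<n (f i)) (≤-<-trans (s≤s⁻¹ (toℕ<n t)) k<N)))

  offset-gap : ∀ (s t : Fin (suc k)) → ∣ toℕ s - toℕ t ∣ ≤ k
  offset-gap s t = ≤-trans (∣m-n∣≤m⊔n (toℕ s) (toℕ t)) (⊔-lub (s≤s⁻¹ (toℕ<n s)) (s≤s⁻¹ (toℕ<n t)))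

  arc-collision : ∀ {i j t s} → arc (i , t) ≡ arc (j , s) →
    ∣ toℕ (f i) - toℕ (f j) ∣ ≡ ∣ toℕ s - toℕ t ∣ ⊎ N ∸ ∣ toℕ (f i) - toℕ (f j) ∣ ≤ ∣ toℕ s - toℕ t ∣
  arc-collision {i} {j} {t} {s} e = wrap-+-collision {N} {toℕ (f i)} {toℕ (f j)} {toℕ s} {toℕ t}
    (trans (sym (toℕ-fromℕ< _)) (trans (cong toℕ e) (toℕ-fromℕ< _)))

  arc-injective : Injective _≡_ _≡_ arc
  arc-injective {i , t} {j , s} e with i ≟ᶠ j
  ... | yes refl = cong (i ,_) (toℕ-injective (sym same-start))
    where
    same-start : toℕ s ≡ toℕ t
    same-start with arc-collision e
    ... | inj₁ 0≡∣s-t∣ = ∣m-n∣≡0⇒m≡n (trans (sym 0≡∣s-t∣) (∣n-n∣≡0 (toℕ (f i))))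
    ... | inj₂ N∸0≤∣s-t∣ = contradiction
            (≤-trans (subst (λ d → N ∸ d ≤ _) (∣n-n∣≡0 (toℕ (f i))) N∸0≤∣s-t∣) (offset-gap s t))
            (<⇒≱ k<N)
  ... | no i≢j = ⊥-elim (independent i j (i≢j ∘ f-injective , close))
    where
    close : distC (f i) (f j) ≤ k
    close with arc-collision e
    ... | inj₁ ∣p-q∣≡∣s-t∣ = ≤-trans (m⊓n≤m _ _) (subst (_≤ k) (sym ∣p-q∣≡∣s-t∣) (offset-gap s t))
    ... | inj₂ N∸∣p-q∣≤∣s-t∣ = ≤-trans (m⊓n≤n _ _) (≤-trans N∸∣p-q∣≤∣s-t∣ (offset-gap s t))

3*[n+1]/3≤n+1 : ∀ n → 3 * ((n + 1) / 3) ≤ n + 1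
3*[n+1]/3≤n+1 n = subst (_≤ n + 1) (*-comm ((n + 1) / 3) 3) (m/n*n≤m (n + 1) 3)

n≤3*[n+1]/3+1 : ∀ n → n ≤ 3 * ((n + 1) / 3) + 1
n≤3*[n+1]/3+1 n = +-cancelʳ-≤ 1 n _ (begin
  n + 1                          ≡⟨ m≡m%n+[m/n]*n (n + 1) 3 ⟩
  (n + 1) % 3 + (n + 1) / 3 * 3  ≤⟨ +-monoˡ-≤ _ (s≤s⁻¹ (m%n<n (n + 1) 3)) ⟩
  2 + (n + 1) / 3 * 3            ≡⟨ reorder ((n + 1) / 3) ⟩
  3 * ((n + 1) / 3) + 1 + 1      ∎)
  where
  open ≤-Reasoning
  reorder : ∀ q → 2 + q * 3 ≡ 3 * q + 1 + 1
  reorder = solve-∀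

≤[n+1]/3 : ∀ {c n} → 3 * c ≤ n + 1 → c ≤ (n + 1) / 3
≤[n+1]/3 {c} 3c≤n+1 = subst (_≤ _) (trans (cong (_/ 3) (*-comm 3 c)) (m*n/n≡m c 3)) (/-monoˡ-≤ 3 3c≤n+1)

-- 3 (b + 1) ≤ N + 1 says that the b + 1 labels 3, 9, …, 3 (2b + 1) all occur.
pathPow-¬isOddPrime : ∀ {N k} b → 3 * suc b ≤ N + 1 → N ≤ b * suc k → ¬ IsOddPrime (PathPow N k)
pathPow-¬isOddPrime b 3[1+b]≤N+1 N≤b[1+k] labeling =
  let (_ , independent) = oddMultiples-independent labeling 1 ≤-refl 3[1+b]≤N+1
  in 1+n≰n (pathPow-independent-≤ independent N≤b[1+k])

3[1+b]+1≤b*4 : ∀ {b} → 4 ≤ b → 3 * suc b + 1 ≤ b * 4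
3[1+b]+1≤b*4 {b} 4≤b = begin
  3 * suc b + 1  ≡⟨ reorder b ⟩
  3 * b + 4      ≤⟨ +-monoʳ-≤ (3 * b) 4≤b ⟩
  3 * b + b      ≡⟨ collect b ⟩
  b * 4          ∎
  where
  open ≤-Reasoning
  reorder : ∀ b → 3 * suc b + 1 ≡ 3 * b + 4
  reorder = solve-∀
  collect : ∀ b → 3 * b + b ≡ b * 4
  collect = solve-∀

3[1+b]+1≤b[1+k] : ∀ {b k} → 2 ≤ b → 4 ≤ k → 3 * suc b + 1 ≤ b * suc k
3[1+b]+1≤b[1+k] {b} {k} 2≤b 4≤k = begin
  3 * suc b + 1  ≡⟨ reorder b ⟩
  3 * b + 4      ≤⟨ +-monoʳ-≤ (3 * b) (*-monoʳ-≤ 2 2≤b) ⟩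
  3 * b + 2 * b  ≡⟨ collect b ⟩
  b * 5          ≤⟨ *-monoʳ-≤ b (s≤s 4≤k) ⟩
  b * suc k      ∎
  where
  open ≤-Reasoning
  reorder : ∀ b → 3 * suc b + 1 ≡ 3 * b + 4
  reorder = solve-∀
  collect : ∀ b → 3 * b + 2 * b ≡ b * 5
  collect = solve-∀

-- Take b + 1 = ⌊(N + 1) / 3⌋, so that N ≤ 3 (b + 1) + 1.
pathPow-¬isOddPrime-large : ∀ {N k} c → 3 * suc c ≤ N + 1 →
  (∀ {b} → c ≤ b → 3 * suc b + 1 ≤ b * suc k) → ¬ IsOddPrime (PathPow N k)
pathPow-¬isOddPrime-large {N} c 3[1+c]≤N+1 3[1+b]+1≤b[1+k]
  with (N + 1) / 3 | 3*[n+1]/3≤n+1 N | n≤3*[n+1]/3+1 N | ≤[n+1]/3 {suc c} 3[1+c]≤N+1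
... | suc b | 3[1+b]≤N+1 | N≤3[1+b]+1 | s≤s c≤b =
  pathPow-¬isOddPrime b 3[1+b]≤N+1 (≤-trans N≤3[1+b]+1 (3[1+b]+1≤b[1+k] c≤b))

pathPow3-¬isOddPrime : ∀ {N} → 14 ≤ N → ¬ IsOddPrime (PathPow N 3)
pathPow3-¬isOddPrime 14≤N = pathPow-¬isOddPrime-large 4 (+-monoˡ-≤ 1 14≤N) 3[1+b]+1≤b*4

pathPow≥4-¬isOddPrime : ∀ {N k} → 4 ≤ k → 8 ≤ N → ¬ IsOddPrime (PathPow N k)
pathPow≥4-¬isOddPrime 4≤k 8≤N = pathPow-¬isOddPrime-large 2 (+-monoˡ-≤ 1 8≤N) (λ 2≤b → 3[1+b]+1≤b[1+k] 2≤b 4≤k)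

cyclePow-¬isOddPrime : ∀ {N k} → 3 ≤ k → k + 2 ≤ N → ¬ IsOddPrime (CyclePow N k)
cyclePow-¬isOddPrime {N} {k} 3≤k k+2≤N labeling = <⇒≱ (begin-strict
    N                  ≤⟨ n≤3*[n+1]/3+1 N ⟩
    3 * q + 1          <⟨ +-monoʳ-< (3 * q) 2≤q ⟩
    3 * q + q          ≡⟨ collect q ⟩
    q * 4              ≤⟨ *-monoʳ-≤ q (s≤s 3≤k) ⟩
    q * suc k          ∎)
  (cyclePow-independent-≤ k<N independent)
  where
  open ≤-Reasoning
  q : ℕ
  q = (N + 1) / 3
  k<N : k < N
  k<N = ≤-trans (n≤1+n (suc k)) (subst (_≤ N) (+-comm k 2) k+2≤N)
  2≤q : 2 ≤ q
  2≤q = ≤[n+1]/3 (+-monoˡ-≤ 1 (≤-trans (+-monoˡ-≤ 2 3≤k) k+2≤N))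
  independent : Independent (CyclePow N k) _
  independent = proj₂ (oddMultiples-independent {m = q} labeling 1 ≤-refl (3*[n+1]/3≤n+1 N))
  collect : ∀ q → 3 * q + q ≡ q * 4
  collect = solve-∀

isPathPowLabeling? : ∀ {n} k (σ : Fin n → Fin n) →
  Dec ((∀ i j → σ i ≡ σ j → i ≡ j) × (∀ y → ∃[ x ] σ x ≡ y) ×
       (∀ u v → u ≢ v → distP u v ≤ k → gcd (oddNum (σ u)) (oddNum (σ v)) ≡ 1))
isPathPowLabeling? k σ =
  all? (λ i → all? λ j → (σ i ≟ᶠ σ j) →-dec (i ≟ᶠ j)) ×-dec
  all? (λ y → any? λ x → σ x ≟ᶠ y) ×-dec
  all? (λ u → all? λ v → ¬? (u ≟ᶠ v) →-dec (distP u v ≤? k) →-dec (gcd (oddNum (σ u)) (oddNum (σ v)) ≟ 1))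

checkedPathPowLabeling : ∀ {n} k (σ : Fin n → Fin n) → {True (isPathPowLabeling? k σ)} →
  IsOddPrime (PathPow n k)
checkedPathPowLabeling k σ {checked} with toWitness checked
... | injective , surjective , coprime =
  σ , ((λ {i} {j} → injective i j) , λ y → proj₁ (surjective y) , λ { refl → proj₂ (surjective y) }) ,
  λ u v (u≢v , close) → coprime u v u≢v close

pathPow-5-3 : IsOddPrime (PathPow 5 3)
pathPow-5-3 = checkedPathPowLabeling 3 (lookup (# 1 ∷ # 0 ∷ # 2 ∷ # 3 ∷ # 4 ∷ []))

pathPow-6-3 : IsOddPrime (PathPow 6 3)
pathPow-6-3 = checkedPathPowLabeling 3 (lookup (# 0 ∷ # 1 ∷ # 2 ∷ # 3 ∷ # 5 ∷ # 4 ∷ []))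

pathPow-7-3 : IsOddPrime (PathPow 7 3)
pathPow-7-3 = checkedPathPowLabeling 3 (lookup (# 0 ∷ # 1 ∷ # 2 ∷ # 3 ∷ # 5 ∷ # 4 ∷ # 6 ∷ []))

pathPow-9-3 : IsOddPrime (PathPow 9 3)
pathPow-9-3 = checkedPathPowLabeling 3 (lookup (# 1 ∷ # 0 ∷ # 2 ∷ # 3 ∷ # 4 ∷ # 5 ∷ # 6 ∷ # 8 ∷ # 7 ∷ []))

pathPow-10-3 : IsOddPrime (PathPow 10 3)
pathPow-10-3 = checkedPathPowLabeling 3 (lookup (# 0 ∷ # 1 ∷ # 2 ∷ # 3 ∷ # 5 ∷ # 4 ∷ # 6 ∷ # 8 ∷ # 9 ∷ # 7 ∷ []))

pathPow-13-3 : IsOddPrime (PathPow 13 3)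
pathPow-13-3 = checkedPathPowLabeling 3
  (lookup (# 1 ∷ # 0 ∷ # 2 ∷ # 3 ∷ # 4 ∷ # 5 ∷ # 6 ∷ # 12 ∷ # 10 ∷ # 8 ∷ # 9 ∷ # 11 ∷ # 7 ∷ []))

pathPow-6-4 : IsOddPrime (PathPow 6 4)
pathPow-6-4 = checkedPathPowLabeling 4 (lookup (# 1 ∷ # 0 ∷ # 2 ∷ # 3 ∷ # 5 ∷ # 4 ∷ []))

pathPow-7-4 : IsOddPrime (PathPow 7 4)
pathPow-7-4 = checkedPathPowLabeling 4 (lookup (# 0 ∷ # 1 ∷ # 2 ∷ # 3 ∷ # 5 ∷ # 6 ∷ # 4 ∷ []))

pathPow-7-5 : IsOddPrime (PathPow 7 5)
pathPow-7-5 = checkedPathPowLabeling 5 (lookup (# 1 ∷ # 0 ∷ # 2 ∷ # 3 ∷ # 5 ∷ # 6 ∷ # 4 ∷ []))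

pathPow3-isOddPrime⇒ : ∀ t → IsOddPrime (PathPow (5 + t) 3) →
  5 + t ≡ 5 ⊎ 5 + t ≡ 6 ⊎ 5 + t ≡ 7 ⊎ 5 + t ≡ 9 ⊎ 5 + t ≡ 10 ⊎ 5 + t ≡ 13
pathPow3-isOddPrime⇒ 0 _ = inj₁ refl
pathPow3-isOddPrime⇒ 1 _ = inj₂ (inj₁ refl)
pathPow3-isOddPrime⇒ 2 _ = inj₂ (inj₂ (inj₁ refl))
pathPow3-isOddPrime⇒ 3 labeling = ⊥-elim (pathPow-¬isOddPrime 2 ≤-refl ≤-refl labeling)
pathPow3-isOddPrime⇒ 4 _ = inj₂ (inj₂ (inj₂ (inj₁ refl)))
pathPow3-isOddPrime⇒ 5 _ = inj₂ (inj₂ (inj₂ (inj₂ (inj₁ refl))))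
pathPow3-isOddPrime⇒ 6 labeling = ⊥-elim (pathPow-¬isOddPrime 3 ≤-refl (n≤1+n 11) labeling)
pathPow3-isOddPrime⇒ 7 labeling = ⊥-elim (pathPow-¬isOddPrime 3 (n≤1+n 12) ≤-refl labeling)
pathPow3-isOddPrime⇒ 8 _ = inj₂ (inj₂ (inj₂ (inj₂ (inj₂ refl))))
pathPow3-isOddPrime⇒ (suc (suc (suc (suc (suc (suc (suc (suc (suc t))))))))) labeling =
  ⊥-elim (pathPow3-¬isOddPrime (m≤m+n 14 t) labeling)

pathPow3-isOddPrime⇔ : ∀ {n} → 5 ≤ n →
  IsOddPrime (PathPow n 3) ⇔ (n ≡ 5 ⊎ n ≡ 6 ⊎ n ≡ 7 ⊎ n ≡ 9 ⊎ n ≡ 10 ⊎ n ≡ 13)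
pathPow3-isOddPrime⇔ 5≤n with m≤n⇒∃[o]m+o≡n 5≤n
... | t , refl = mk⇔ (pathPow3-isOddPrime⇒ t) λ
  { (inj₁ refl) → pathPow-5-3
  ; (inj₂ (inj₁ refl)) → pathPow-6-3
  ; (inj₂ (inj₂ (inj₁ refl))) → pathPow-7-3
  ; (inj₂ (inj₂ (inj₂ (inj₁ refl)))) → pathPow-9-3
  ; (inj₂ (inj₂ (inj₂ (inj₂ (inj₁ refl))))) → pathPow-10-3
  ; (inj₂ (inj₂ (inj₂ (inj₂ (inj₂ refl))))) → pathPow-13-3
  }

pathPow4-isOddPrime⇒ : ∀ t → IsOddPrime (PathPow (6 + t) 4) → 6 + t ≡ 6 ⊎ 6 + t ≡ 7
pathPow4-isOddPrime⇒ 0 _ = inj₁ refl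
pathPow4-isOddPrime⇒ 1 _ = inj₂ refl
pathPow4-isOddPrime⇒ (suc (suc t)) labeling =
  ⊥-elim (pathPow≥4-¬isOddPrime ≤-refl (m≤m+n 8 t) labeling)

pathPow4-isOddPrime⇔ : ∀ {n} → 6 ≤ n → IsOddPrime (PathPow n 4) ⇔ (n ≡ 6 ⊎ n ≡ 7)
pathPow4-isOddPrime⇔ 6≤n with m≤n⇒∃[o]m+o≡n 6≤n
... | t , refl = mk⇔ (pathPow4-isOddPrime⇒ t) λ
  { (inj₁ refl) → pathPow-6-4
  ; (inj₂ refl) → pathPow-7-4
  }

pathPow5-isOddPrime⇒ : ∀ t → IsOddPrime (PathPow (7 + t) 5) → 7 + t ≡ 7
pathPow5-isOddPrime⇒ 0 _ = refl
pathPow5-isOddPrime⇒ (suc t) labeling =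
  ⊥-elim (pathPow≥4-¬isOddPrime (n≤1+n 4) (m≤m+n 8 t) labeling)

pathPow5-isOddPrime⇔ : ∀ {n} → 7 ≤ n → IsOddPrime (PathPow n 5) ⇔ n ≡ 7
pathPow5-isOddPrime⇔ 7≤n with m≤n⇒∃[o]m+o≡n 7≤n
... | t , refl = mk⇔ (pathPow5-isOddPrime⇒ t) λ { refl → pathPow-7-5 }

mainTheorem18 : (k n : ℕ) → 3 ≤ k → k + 2 ≤ n →
    ((k ≡ 3 → (IsOddPrime (PathPow n 3) ⇔ (n ≡ 5 ⊎ n ≡ 6 ⊎ n ≡ 7 ⊎ n ≡ 9 ⊎ n ≡ 10 ⊎ n ≡ 13)))
    × (k ≡ 4 → (IsOddPrime (PathPow n 4) ⇔ (n ≡ 6 ⊎ n ≡ 7)))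
    × (k ≡ 5 → (IsOddPrime (PathPow n 5) ⇔ n ≡ 7))
    × (6 ≤ k → ¬ IsOddPrime (PathPow n k))
    × ¬ IsOddPrime (CyclePow n k))
mainTheorem18 k n 3≤k k+2≤n =
    (λ { refl → pathPow3-isOddPrime⇔ k+2≤n })
  , (λ { refl → pathPow4-isOddPrime⇔ k+2≤n })
  , (λ { refl → pathPow5-isOddPrime⇔ k+2≤n })
  , (λ 6≤k → pathPow≥4-¬isOddPrime (≤-trans (m≤m+n 4 2) 6≤k) (≤-trans (+-monoˡ-≤ 2 6≤k) k+2≤n))
  , cyclePow-¬isOddPrime 3≤k k+2≤n
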